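{- Let $k,m\ge1$ be integers and $\gamma\in(0,1)$. Let $\mathcal{D}_{\mathsf{pure}}^{\otimes m}$ be the distribution of $m$ i.i.d. samples from the pure-case distribution and $\mathcal{D}_{\mathsf{mixed}}^{\otimes m}$ the distribution of $m$ i.i.d. samples from the mixed-case distribution (i.e., the uniform mixture, over the $2^{4k}$ choices of $(\mu(x_1),\dots,\mu(x_{4k}))\in\{0,1\}^{4k}$, of the corresponding $m$-fold product distributions), as described in the context. Then $d_{\mathsf{TV}}(\mathcal{D}_{\mathsf{pure}}^{\otimes m},\mathcal{D}_{\mathsf{mixed}}^{\otimes m})\le\frac{m^2\gamma^2}{32k}$.
   Context: Domain $\mathcal{X}=\{\bot,x^-,x^+,x_1,\dots,x_{4k}\}$. Distribution $\mathcal{D}$ over $\mathcal{X}\times\{0,1\}$: marginal $\mathcal{D}_x(\bot)=1-\gamma$, $\mathcal{D}_x(x^-)=\mathcal{D}_x(x^+)=\gamma/4$, $\mathcal{D}_x(x_i)=\gamma/(8k)$ for $i\in[4k]$; conditional probabilities $\mu(x)=\Pr[y=1\mid x]$ with $\mu(\bot)=\mu(x^-)=\mu(x^+)=\frac12$; in the pure case $\mu(x_i)=\frac12$ for all $i$; in the mixed case $\mu(x_1),\dots,\mu(x_{4k})$ are independent $\mathrm{Bernoulli}(1/2)$. $d_{\mathsf{TV}}$ is total variation distance.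
   Formalization: The parameter γ takes only rational values in the interval (0,1). -}

module Defs where

open import Data.Nat as ℕ using (ℕ; zero; suc)
open import Data.Integer using (+_)
open import Data.Rational using (ℚ; _+_; _*_; _-_; ∣_∣; ½; 0ℚ; 1ℚ; _/_)
open import Data.Bool using (Bool; true; false; if_then_else_)
open import Data.Bool.Properties using () renaming (_≟_ to _≟B_)
open import Relation.Nullary using (does)
open import Data.Fin using (Fin)
open import Data.Product using (_×_; _,_)
open import Data.List using (List; []; _∷_; map; concatMap; foldr)
open import Data.List.Base using (allFin)
open import Data.Vec as Vec using (Vec; []; _∷_; lookup)

-- ℚ-valued reciprocal of a natural number: inv n = 1/n for n ≥ 1
-- (inv 0 = 0 is a junk value never used, since k ≥ 1 is assumed).
inv : ℕ → ℚ
inv zero = 0ℚ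
inv (suc n) = + 1 / suc n

ℕ→ℚ : ℕ → ℚ
ℕ→ℚ n = + n / 1

pow : ℚ → ℕ → ℚ
pow q zero = 1ℚ
pow q (suc n) = q * pow q n

sumL : List ℚ → ℚ
sumL = foldr _+_ 0ℚ

prodV : ∀ {A : Set} {m} → (A → ℚ) → Vec A m → ℚ
prodV f [] = 1ℚ
prodV f (a ∷ as) = f a * prodV f as

allVec : ∀ {A : Set} → List A → (m : ℕ) → List (Vec A m)
allVec xs zero = [] ∷ []
allVec xs (suc m) = concatMap (λ x → map (x ∷_) (allVec xs m)) xs

data Pt (k : ℕ) : Set where
  bot : Pt k
  xminus : Pt k
  xplus : Pt k
  xi : Fin (4 ℕ.* k) → Pt k

allPt : (k : ℕ) → List (Pt k)
allPt k = bot ∷ xminus ∷ xplus ∷ map xi (allFin (4 ℕ.* k))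

-- all labelled examples (x , y) ∈ 𝒳 × {0,1}   (y = true means label 1)
allXY : (k : ℕ) → List (Pt k × Bool)
allXY k = concatMap (λ x → (x , false) ∷ (x , true) ∷ []) (allPt k)

Dx : (k : ℕ) → ℚ → Pt k → ℚ
Dx k γ bot = 1ℚ - γ
Dx k γ xminus = γ * inv 4
Dx k γ xplus = γ * inv 4
Dx k γ (xi i) = γ * inv (8 ℕ.* k)

-- Pr[y | x] given μ(x) = Pr[y = 1 | x]
condProb : ℚ → Bool → ℚ
condProb μ true = μ
condProb μ false = 1ℚ - μ

μpure : (k : ℕ) → Pt k → ℚ
μpure k x = ½

bit : Bool → ℚ
bit true = 1ℚ
bit false = 0ℚ

μmixed : (k : ℕ) → Vec Bool (4 ℕ.* k) → Pt k → ℚ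
μmixed k b (xi i) = bit (lookup b i)
μmixed k b _ = ½

D1 : (k : ℕ) → ℚ → (Pt k → ℚ) → Pt k × Bool → ℚ
D1 k γ μ (x , y) = Dx k γ x * condProb (μ x) y

Dpure : (k m : ℕ) → ℚ → Vec (Pt k × Bool) m → ℚ
Dpure k m γ s = prodV (D1 k γ (μpure k)) s

Dmixed : (k m : ℕ) → ℚ → Vec (Pt k × Bool) m → ℚ
Dmixed k m γ s =
  pow ½ (4 ℕ.* k) * sumL (map (λ b → prodV (D1 k γ (μmixed k b)) s)
                               (allVec (false ∷ true ∷ []) (4 ℕ.* k)))

dTV : (k m : ℕ) → (Vec (Pt k × Bool) m → ℚ) → (Vec (Pt k × Bool) m → ℚ) → ℚ
dTV k m P Q = ½ * sumL (map (λ s → ∣ P s - Q s ∣) (allVec (allXY k) m))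

{-# OPTIONS --safe #-}
-- Write w for the single-sample law of the pure case, q b for that of the mixed case with bits b, and
-- Q for the uniform mixture over b of the products (q b)^⊗m.  Peeling off the first sample,
-- Q (a ∷ s) = w a · Q s + T a s, where T a s averages (q b a − w a) · (q b)^⊗m s over b; so the ℓ₁
-- distance between w^⊗(m+1) and Q exceeds the one for m samples by at most ∑_{a,s} |T a s|.
-- T vanishes unless a = (x_i, y), and there q b a − w a = ±p/2 (p = γ/8k) changes sign when bit i of b
-- is flipped.  Pairing b with its flip bounds ∑_s |T a s| by p/4 times the average ℓ₁ distance between
-- (q b)^⊗m and (q b′)^⊗m, which is at most m · ℓ₁(q b, q b′) = 2mp.  The 8k points (x_i, y) therefore add
-- at most 4k·m·p² per sample, the ℓ₁ distance after m samples is at most m² · 4k p², and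
-- d_TV ≤ ½ m² · 4k · γ²/(64k²) = m²γ²/(32k).
module Submission where

open import Defs
open import Data.Nat as ℕ using (ℕ)
open import Data.Rational using (ℚ; _*_; _≤_; _<_; 0ℚ; 1ℚ)

open import Data.Bool using (Bool; true; false; not)
open import Data.Fin using (Fin; zero; suc)
open import Data.Fin.Properties using (suc-injective)
import Data.Integer as ℤ
import Data.Integer.Properties as ℤ
open import Data.List using (List; []; _∷_; _++_; map; concatMap; length; allFin)
import Data.List.Properties as List
open import Data.Nat using (zero; suc)
import Data.Nat.Properties as ℕ
import Data.Nat.Tactic.RingSolver as ℕ-Ring
open import Data.Product using (_×_; _,_)
open import Data.Rational using (_+_; _-_; -_; ∣_∣; ½; toℚᵘ)
open import Data.Rational.Base using (nonNegative)
import Data.Rational.Properties as ℚ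
open import Data.Rational.Unnormalised as ℚᵘ using (mkℚᵘ; *≡*)
import Data.Rational.Unnormalised.Properties as ℚᵘ
open import Data.Vec using (Vec; []; _∷_; lookup; updateAt; replicate)
import Data.Vec.Properties as Vec
open import Function using (_∘_; id)
open import Level using (0ℓ)
open import Relation.Binary.PropositionalEquality using (_≡_; refl; sym; trans; cong; cong₂; module ≡-Reasoning)
open import Relation.Nullary using (¬_)
open import Relation.Nullary.Decidable using (dec⇒maybe)
open import Tactic.RingSolver using (solve-∀)
import Tactic.RingSolver.Core.AlmostCommutativeRing as ACR

private variable
  A B : Set

ℚ-ring : ACR.AlmostCommutativeRing 0ℓ 0ℓ
ℚ-ring = ACR.fromCommutativeRing ℚ.+-*-commutativeRing (λ p → dec⇒maybe (0ℚ ℚ.≟ p))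

*-monoˡ-≤-0≤ : ∀ {r p q} → 0ℚ ≤ r → p ≤ q → r * p ≤ r * q
*-monoˡ-≤-0≤ {r} 0≤r = ℚ.*-monoˡ-≤-nonNeg r {{nonNegative 0≤r}}

*-monoʳ-≤-0≤ : ∀ {r p q} → 0ℚ ≤ r → p ≤ q → p * r ≤ q * r
*-monoʳ-≤-0≤ {r} 0≤r = ℚ.*-monoʳ-≤-nonNeg r {{nonNegative 0≤r}}

0≤-* : ∀ {p q} → 0ℚ ≤ p → 0ℚ ≤ q → 0ℚ ≤ p * q
0≤-* {p} 0≤p 0≤q = ℚ.≤-trans (ℚ.≤-reflexive (sym (ℚ.*-zeroʳ p))) (*-monoˡ-≤-0≤ 0≤p 0≤q)

p≤q⇒0≤q-p : ∀ {p q} → p ≤ q → 0ℚ ≤ q - p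
p≤q⇒0≤q-p {p} p≤q = ℚ.≤-trans (ℚ.≤-reflexive (sym (ℚ.+-inverseʳ p))) (ℚ.+-monoˡ-≤ (- p) p≤q)

∣r*p∣≡r*∣p∣ : ∀ {r} p → 0ℚ ≤ r → ∣ r * p ∣ ≡ r * ∣ p ∣
∣r*p∣≡r*∣p∣ {r} p 0≤r = trans (ℚ.∣p*q∣≡∣p∣*∣q∣ r p) (cong (_* ∣ p ∣) (ℚ.0≤p⇒∣p∣≡p 0≤r))

∣p-p∣≡0 : ∀ p → ∣ p - p ∣ ≡ 0ℚ
∣p-p∣≡0 p = cong ∣_∣ (ℚ.+-inverseʳ p)

*-distribˡ-minus : ∀ r p q → r * (p - q) ≡ r * p - r * q
*-distribˡ-minus = solve-∀ ℚ-ring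

toℚᵘ-ℕ→ℚ : ∀ n → toℚᵘ (ℕ→ℚ n) ℚᵘ.≃ mkℚᵘ (ℤ.+ n) 0
toℚᵘ-ℕ→ℚ n = ℚ.toℚᵘ-fromℚᵘ (mkℚᵘ (ℤ.+ n) 0)

ℕ→ℚ-+ : ∀ a b → ℕ→ℚ (a ℕ.+ b) ≡ ℕ→ℚ a + ℕ→ℚ b
ℕ→ℚ-+ a b = ℚ.toℚᵘ-injective (begin-equality
  toℚᵘ (ℕ→ℚ (a ℕ.+ b))
    ≃⟨ toℚᵘ-ℕ→ℚ (a ℕ.+ b) ⟩
  mkℚᵘ (ℤ.+ (a ℕ.+ b)) 0
    ≃⟨ *≡* (cong (ℤ._* ℤ.+ 1) (trans (ℤ.pos-+ a b) (sym (cong₂ ℤ._+_ (ℤ.*-identityʳ (ℤ.+ a)) (ℤ.*-identityʳ (ℤ.+ b)))))) ⟩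
  mkℚᵘ (ℤ.+ a) 0 ℚᵘ.+ mkℚᵘ (ℤ.+ b) 0
    ≃⟨ ℚᵘ.+-cong (ℚᵘ.≃-sym (toℚᵘ-ℕ→ℚ a)) (ℚᵘ.≃-sym (toℚᵘ-ℕ→ℚ b)) ⟩
  toℚᵘ (ℕ→ℚ a) ℚᵘ.+ toℚᵘ (ℕ→ℚ b)
    ≃⟨ ℚᵘ.≃-sym (ℚ.toℚᵘ-homo-+ (ℕ→ℚ a) (ℕ→ℚ b)) ⟩
  toℚᵘ (ℕ→ℚ a + ℕ→ℚ b)
    ∎)
  where open ℚᵘ.≤-Reasoning

ℕ→ℚ-* : ∀ a b → ℕ→ℚ (a ℕ.* b) ≡ ℕ→ℚ a * ℕ→ℚ b
ℕ→ℚ-* a b = ℚ.toℚᵘ-injective (begin-equality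
  toℚᵘ (ℕ→ℚ (a ℕ.* b))                  ≃⟨ toℚᵘ-ℕ→ℚ (a ℕ.* b) ⟩
  mkℚᵘ (ℤ.+ (a ℕ.* b)) 0                ≃⟨ *≡* (cong (ℤ._* ℤ.+ 1) (ℤ.pos-* a b)) ⟩
  mkℚᵘ (ℤ.+ a) 0 ℚᵘ.* mkℚᵘ (ℤ.+ b) 0    ≃⟨ ℚᵘ.*-cong (ℚᵘ.≃-sym (toℚᵘ-ℕ→ℚ a)) (ℚᵘ.≃-sym (toℚᵘ-ℕ→ℚ b)) ⟩
  toℚᵘ (ℕ→ℚ a) ℚᵘ.* toℚᵘ (ℕ→ℚ b)        ≃⟨ ℚᵘ.≃-sym (ℚ.toℚᵘ-homo-* (ℕ→ℚ a) (ℕ→ℚ b)) ⟩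
  toℚᵘ (ℕ→ℚ a * ℕ→ℚ b)                  ∎)
  where open ℚᵘ.≤-Reasoning

ℕ→ℚ*inv : ∀ n → .{{ℕ.NonZero n}} → ℕ→ℚ n * inv n ≡ 1ℚ
ℕ→ℚ*inv (suc n) = ℚ.toℚᵘ-injective (begin-equality
  toℚᵘ (ℕ→ℚ (suc n) * inv (suc n))             ≃⟨ ℚ.toℚᵘ-homo-* (ℕ→ℚ (suc n)) (inv (suc n)) ⟩
  toℚᵘ (ℕ→ℚ (suc n)) ℚᵘ.* toℚᵘ (inv (suc n))   ≃⟨ ℚᵘ.*-cong (toℚᵘ-ℕ→ℚ (suc n)) (ℚ.toℚᵘ-fromℚᵘ (mkℚᵘ (ℤ.+ 1) n)) ⟩
  mkℚᵘ (ℤ.+ suc n) 0 ℚᵘ.* mkℚᵘ (ℤ.+ 1) n       ≃⟨ *≡* (cong (λ z → ℤ.+ suc z) (n*1*1≡n+0+0 n)) ⟩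
  toℚᵘ 1ℚ                                      ∎)
  where
  open ℚᵘ.≤-Reasoning
  n*1*1≡n+0+0 : ∀ n → n ℕ.* 1 ℕ.* 1 ≡ n ℕ.+ 0 ℕ.+ 0
  n*1*1≡n+0+0 = ℕ-Ring.solve-∀

ℕ→ℚ-nonNeg : ∀ n → 0ℚ ≤ ℕ→ℚ n
ℕ→ℚ-nonNeg n = ℚ.nonNegative⁻¹ (ℕ→ℚ n) {{ℚ.normalize-nonNeg n 1}}

ℕ→ℚ-mono-≤ : ∀ {a b} → a ℕ.≤ b → ℕ→ℚ a ≤ ℕ→ℚ b
ℕ→ℚ-mono-≤ {a} a≤b with ℕ.m≤n⇒∃[o]m+o≡n a≤b
... | c , refl = begin
  ℕ→ℚ a                 ≡⟨ ℚ.+-identityʳ (ℕ→ℚ a) ⟨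
  ℕ→ℚ a + 0ℚ            ≤⟨ ℚ.+-monoʳ-≤ (ℕ→ℚ a) (ℕ→ℚ-nonNeg c) ⟩
  ℕ→ℚ a + ℕ→ℚ c         ≡⟨ ℕ→ℚ-+ a c ⟨
  ℕ→ℚ (a ℕ.+ c)         ∎
  where open ℚ.≤-Reasoning

quadratic-growth : ∀ (e : ℕ → ℚ) {H} → 0ℚ ≤ H → e 0 ≡ 0ℚ → (∀ m → e (suc m) ≤ e m + ℕ→ℚ m * H) →
                   ∀ m → e m ≤ ℕ→ℚ (m ℕ.* m) * H
quadratic-growth e {H} 0≤H e0≡0 step zero    = ℚ.≤-reflexive (trans e0≡0 (sym (ℚ.*-zeroˡ H)))
quadratic-growth e {H} 0≤H e0≡0 step (suc m) = begin
  e (suc m)                          ≤⟨ step m ⟩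
  e m + ℕ→ℚ m * H                    ≤⟨ ℚ.+-monoˡ-≤ (ℕ→ℚ m * H) (quadratic-growth e 0≤H e0≡0 step m) ⟩
  ℕ→ℚ (m ℕ.* m) * H + ℕ→ℚ m * H      ≡⟨ ℚ.*-distribʳ-+ H (ℕ→ℚ (m ℕ.* m)) (ℕ→ℚ m) ⟨
  (ℕ→ℚ (m ℕ.* m) + ℕ→ℚ m) * H        ≡⟨ cong (_* H) (ℕ→ℚ-+ (m ℕ.* m) m) ⟨
  ℕ→ℚ (m ℕ.* m ℕ.+ m) * H            ≤⟨ *-monoʳ-≤-0≤ 0≤H (ℕ→ℚ-mono-≤ m²+m≤[1+m]²) ⟩
  ℕ→ℚ (suc m ℕ.* suc m) * H          ∎
  where
  open ℚ.≤-Reasoning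
  square-suc : ∀ m → suc m ℕ.+ (m ℕ.* m ℕ.+ m) ≡ suc m ℕ.* suc m
  square-suc = ℕ-Ring.solve-∀
  m²+m≤[1+m]² : m ℕ.* m ℕ.+ m ℕ.≤ suc m ℕ.* suc m
  m²+m≤[1+m]² = ℕ.≤-trans (ℕ.m≤n+m (m ℕ.* m ℕ.+ m) (suc m)) (ℕ.≤-reflexive (square-suc m))

∑ : List A → (A → ℚ) → ℚ
∑ xs f = sumL (map f xs)

syntax ∑ xs (λ x → e) = ∑[ x ∈ xs ] e

∑-cong : ∀ xs {f g : A → ℚ} → (∀ x → f x ≡ g x) → ∑ xs f ≡ ∑ xs g
∑-cong []       f≗g = refl
∑-cong (x ∷ xs) f≗g = cong₂ _+_ (f≗g x) (∑-cong xs f≗g)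

∑-mono-≤ : ∀ xs {f g : A → ℚ} → (∀ x → f x ≤ g x) → ∑ xs f ≤ ∑ xs g
∑-mono-≤ []       f≤g = ℚ.≤-refl
∑-mono-≤ (x ∷ xs) f≤g = ℚ.+-mono-≤ (f≤g x) (∑-mono-≤ xs f≤g)

∑-++ : ∀ xs ys (f : A → ℚ) → ∑ (xs ++ ys) f ≡ ∑ xs f + ∑ ys f
∑-++ []       ys f = sym (ℚ.+-identityˡ (∑ ys f))
∑-++ (x ∷ xs) ys f = trans (cong (f x +_) (∑-++ xs ys f)) (sym (ℚ.+-assoc (f x) (∑ xs f) (∑ ys f)))

∑-map : ∀ (g : B → A) xs (f : A → ℚ) → ∑ (map g xs) f ≡ ∑ xs (f ∘ g)
∑-map g []       f = refl
∑-map g (x ∷ xs) f = cong (f (g x) +_) (∑-map g xs f)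

∑-concatMap : ∀ (g : B → List A) xs (f : A → ℚ) → ∑ (concatMap g xs) f ≡ ∑[ x ∈ xs ] ∑ (g x) f
∑-concatMap g []       f = refl
∑-concatMap g (x ∷ xs) f = trans (∑-++ (g x) (concatMap g xs) f) (cong (∑ (g x) f +_) (∑-concatMap g xs f))

∑-distrib-+ : ∀ xs (f g : A → ℚ) → ∑[ x ∈ xs ] (f x + g x) ≡ ∑ xs f + ∑ xs g
∑-distrib-+ []       f g = refl
∑-distrib-+ (x ∷ xs) f g =
  trans (cong (f x + g x +_) (∑-distrib-+ xs f g)) (interchange (f x) (g x) (∑ xs f) (∑ xs g))
  where
  interchange : ∀ a b c d → (a + b) + (c + d) ≡ (a + c) + (b + d)
  interchange = solve-∀ ℚ-ring

*-distribˡ-∑ : ∀ c xs (f : A → ℚ) → c * ∑ xs f ≡ ∑[ x ∈ xs ] (c * f x)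
*-distribˡ-∑ c []       f = ℚ.*-zeroʳ c
*-distribˡ-∑ c (x ∷ xs) f = trans (ℚ.*-distribˡ-+ c (f x) (∑ xs f)) (cong (c * f x +_) (*-distribˡ-∑ c xs f))

*-distribʳ-∑ : ∀ c xs (f : A → ℚ) → ∑ xs f * c ≡ ∑[ x ∈ xs ] (f x * c)
*-distribʳ-∑ c xs f =
  trans (ℚ.*-comm (∑ xs f) c) (trans (*-distribˡ-∑ c xs f) (∑-cong xs (λ x → ℚ.*-comm c (f x))))

∑-const : ∀ (xs : List A) c → ∑[ x ∈ xs ] c ≡ ℕ→ℚ (length xs) * c
∑-const []       c = sym (ℚ.*-zeroˡ c)
∑-const (x ∷ xs) c = begin
  c + ∑[ x ∈ xs ] c                ≡⟨ cong (c +_) (∑-const xs c) ⟩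
  c + ℕ→ℚ (length xs) * c          ≡⟨ 1+n*c (ℕ→ℚ (length xs)) c ⟩
  (1ℚ + ℕ→ℚ (length xs)) * c       ≡⟨ cong (_* c) (ℕ→ℚ-+ 1 (length xs)) ⟨
  ℕ→ℚ (suc (length xs)) * c        ∎
  where
  open ≡-Reasoning
  1+n*c : ∀ n c → c + n * c ≡ (1ℚ + n) * c
  1+n*c = solve-∀ ℚ-ring

∑-zero : ∀ (xs : List A) → ∑[ x ∈ xs ] 0ℚ ≡ 0ℚ
∑-zero xs = trans (∑-const xs 0ℚ) (ℚ.*-zeroʳ (ℕ→ℚ (length xs)))

∣∑∣≤∑∣∣ : ∀ xs (f : A → ℚ) → ∣ ∑ xs f ∣ ≤ ∑[ x ∈ xs ] ∣ f x ∣
∣∑∣≤∑∣∣ []       f = ℚ.≤-refl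
∣∑∣≤∑∣∣ (x ∷ xs) f = ℚ.≤-trans (ℚ.∣p+q∣≤∣p∣+∣q∣ (f x) (∑ xs f)) (ℚ.+-monoʳ-≤ ∣ f x ∣ (∣∑∣≤∑∣∣ xs f))

∑-comm : ∀ xs (ys : List B) (G : A → B → ℚ) →
         ∑[ x ∈ xs ] ∑[ y ∈ ys ] G x y ≡ ∑[ y ∈ ys ] ∑[ x ∈ xs ] G x y
∑-comm []       ys G = sym (∑-zero ys)
∑-comm (x ∷ xs) ys G = trans (cong (∑ ys (G x) +_) (∑-comm xs ys G))
                             (sym (∑-distrib-+ ys (G x) (λ y → ∑[ x ∈ xs ] G x y)))

∑-∑-*-+ : ∀ xs (ys : List B) (u : A → ℚ) (X : B → ℚ) (Y : A → B → ℚ) →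
          ∑[ a ∈ xs ] ∑[ s ∈ ys ] (u a * X s + Y a s) ≡ ∑ xs u * ∑ ys X + ∑[ a ∈ xs ] ∑ ys (Y a)
∑-∑-*-+ xs ys u X Y = begin
  ∑[ a ∈ xs ] ∑[ s ∈ ys ] (u a * X s + Y a s)
    ≡⟨ ∑-cong xs (λ a → ∑-distrib-+ ys (λ s → u a * X s) (Y a)) ⟩
  ∑[ a ∈ xs ] (∑[ s ∈ ys ] (u a * X s) + ∑ ys (Y a))
    ≡⟨ ∑-cong xs (λ a → cong (_+ ∑ ys (Y a)) (*-distribˡ-∑ (u a) ys X)) ⟨
  ∑[ a ∈ xs ] (u a * ∑ ys X + ∑ ys (Y a))
    ≡⟨ ∑-distrib-+ xs (λ a → u a * ∑ ys X) (λ a → ∑ ys (Y a)) ⟩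
  ∑[ a ∈ xs ] (u a * ∑ ys X) + ∑[ a ∈ xs ] ∑ ys (Y a)
    ≡⟨ cong (_+ ∑[ a ∈ xs ] ∑ ys (Y a)) (*-distribʳ-∑ (∑ ys X) xs u) ⟨
  ∑ xs u * ∑ ys X + ∑[ a ∈ xs ] ∑ ys (Y a)
    ∎
  where open ≡-Reasoning

∑-allVec-suc : ∀ L m (G : Vec A (suc m) → ℚ) →
               ∑ (allVec L (suc m)) G ≡ ∑[ a ∈ L ] ∑[ s ∈ allVec L m ] G (a ∷ s)
∑-allVec-suc L m G = trans (∑-concatMap (λ a → map (a ∷_) (allVec L m)) L G)
                           (∑-cong L (λ a → ∑-map (a ∷_) (allVec L m) G))

∑-allFin-suc : ∀ n (f : Fin (suc n) → ℚ) → ∑ (allFin (suc n)) f ≡ f zero + ∑ (allFin n) (f ∘ suc)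
∑-allFin-suc n f = cong (λ xs → f zero + sumL xs)
  (trans (List.map-tabulate suc f) (sym (List.map-tabulate id (f ∘ suc))))

∑-allFin-const : ∀ n c → ∑[ i ∈ allFin n ] c ≡ ℕ→ℚ n * c
∑-allFin-const n c = trans (∑-const (allFin n) c) (cong (λ l → ℕ→ℚ l * c) (List.length-tabulate {n = n} id))

∑-allFin-single : ∀ {n} (i : Fin n) (f : Fin n → ℚ) → (∀ j → ¬ j ≡ i → f j ≡ 0ℚ) → ∑ (allFin n) f ≡ f i
∑-allFin-single {suc n} zero    f f≡0 = begin
  ∑ (allFin (suc n)) f               ≡⟨ ∑-allFin-suc n f ⟩
  f zero + ∑ (allFin n) (f ∘ suc)    ≡⟨ cong (f zero +_) (trans (∑-cong (allFin n) rest≡0) (∑-zero (allFin n))) ⟩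
  f zero + 0ℚ                        ≡⟨ ℚ.+-identityʳ (f zero) ⟩
  f zero                             ∎
  where
  open ≡-Reasoning
  rest≡0 : ∀ j → f (suc j) ≡ 0ℚ
  rest≡0 j = f≡0 (suc j) λ ()
∑-allFin-single {suc n} (suc i) f f≡0 = begin
  ∑ (allFin (suc n)) f               ≡⟨ ∑-allFin-suc n f ⟩
  f zero + ∑ (allFin n) (f ∘ suc)    ≡⟨ cong₂ _+_ (f≡0 zero λ ()) (∑-allFin-single i (f ∘ suc) rest≡0) ⟩
  0ℚ + f (suc i)                     ≡⟨ ℚ.+-identityˡ (f (suc i)) ⟩
  f (suc i)                          ∎
  where
  open ≡-Reasoning
  rest≡0 : ∀ j → ¬ j ≡ i → f (suc j) ≡ 0ℚ
  rest≡0 j j≢i = f≡0 (suc j) (j≢i ∘ suc-injective)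

∣ux-vy∣≤u∣x-y∣+∣u-v∣y : ∀ {u} v x {y} → 0ℚ ≤ u → 0ℚ ≤ y → ∣ u * x - v * y ∣ ≤ u * ∣ x - y ∣ + ∣ u - v ∣ * y
∣ux-vy∣≤u∣x-y∣+∣u-v∣y {u} v x {y} 0≤u 0≤y = begin
  ∣ u * x - v * y ∣                    ≡⟨ cong ∣_∣ (split u v x y) ⟩
  ∣ u * (x - y) + (u - v) * y ∣        ≤⟨ ℚ.∣p+q∣≤∣p∣+∣q∣ (u * (x - y)) ((u - v) * y) ⟩
  ∣ u * (x - y) ∣ + ∣ (u - v) * y ∣    ≡⟨ cong₂ _+_ (∣r*p∣≡r*∣p∣ (x - y) 0≤u) ∣[u-v]*y∣ ⟩
  u * ∣ x - y ∣ + ∣ u - v ∣ * y        ∎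
  where
  open ℚ.≤-Reasoning
  split : ∀ u v x y → u * x - v * y ≡ u * (x - y) + (u - v) * y
  split = solve-∀ ℚ-ring
  ∣[u-v]*y∣ : ∣ (u - v) * y ∣ ≡ ∣ u - v ∣ * y
  ∣[u-v]*y∣ = trans (ℚ.∣p*q∣≡∣p∣*∣q∣ (u - v) y) (cong (∣ u - v ∣ *_) (ℚ.0≤p⇒∣p∣≡p 0≤y))

∣ux-[uy+t]∣≤u∣x-y∣+∣t∣ : ∀ {u} x y t → 0ℚ ≤ u → ∣ u * x - (u * y + t) ∣ ≤ u * ∣ x - y ∣ + ∣ t ∣
∣ux-[uy+t]∣≤u∣x-y∣+∣t∣ {u} x y t 0≤u = begin
  ∣ u * x - (u * y + t) ∣     ≡⟨ cong ∣_∣ (regroup u x y t) ⟩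
  ∣ u * (x - y) - t ∣         ≤⟨ ℚ.∣p-q∣≤∣p∣+∣q∣ (u * (x - y)) t ⟩
  ∣ u * (x - y) ∣ + ∣ t ∣     ≡⟨ cong (_+ ∣ t ∣) (∣r*p∣≡r*∣p∣ (x - y) 0≤u) ⟩
  u * ∣ x - y ∣ + ∣ t ∣       ∎
  where
  open ℚ.≤-Reasoning
  regroup : ∀ u x y t → u * x - (u * y + t) ≡ u * (x - y) - t
  regroup = solve-∀ ℚ-ring

ℓ₁ : List A → (A → ℚ) → (A → ℚ) → ℚ
ℓ₁ L f g = ∑[ x ∈ L ] ∣ f x - g x ∣

record IsPMF (L : List A) (f : A → ℚ) : Set where
  field
    nonNeg : ∀ x → 0ℚ ≤ f x
    total  : ∑ L f ≡ 1ℚ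

module _ {L : List A} where

  prodV-isPMF : ∀ {f} → IsPMF L f → ∀ m → IsPMF (allVec L m) (prodV f)
  prodV-isPMF {f} pmf m = record { nonNeg = prodV-nonNeg ; total = prodV-total m }
    where
    open IsPMF pmf
    prodV-nonNeg : ∀ {m} (s : Vec A m) → 0ℚ ≤ prodV f s
    prodV-nonNeg []      = ℚ.nonNegative⁻¹ 1ℚ
    prodV-nonNeg (a ∷ s) = 0≤-* (nonNeg a) (prodV-nonNeg s)
    prodV-total : ∀ m → ∑ (allVec L m) (prodV f) ≡ 1ℚ
    prodV-total zero    = refl
    prodV-total (suc m) = begin
      ∑ (allVec L (suc m)) (prodV f)
        ≡⟨ ∑-allVec-suc L m (prodV f) ⟩
      ∑[ a ∈ L ] ∑[ s ∈ allVec L m ] (f a * prodV f s)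
        ≡⟨ ∑-cong L (λ a → *-distribˡ-∑ (f a) (allVec L m) (prodV f)) ⟨
      ∑[ a ∈ L ] (f a * ∑ (allVec L m) (prodV f))
        ≡⟨ ∑-cong L (λ a → trans (cong (f a *_) (prodV-total m)) (ℚ.*-identityʳ (f a))) ⟩
      ∑ L f
        ≡⟨ total ⟩
      1ℚ
        ∎
      where open ≡-Reasoning

  ℓ₁-prodV-suc≤ : ∀ {f g} → IsPMF L f → IsPMF L g → ∀ m →
                  ℓ₁ (allVec L (suc m)) (prodV f) (prodV g) ≤ ℓ₁ (allVec L m) (prodV f) (prodV g) + ℓ₁ L f g
  ℓ₁-prodV-suc≤ {f} {g} f-pmf g-pmf m = begin
    ℓ₁ (allVec L (suc m)) (prodV f) (prodV g)
      ≡⟨ ∑-allVec-suc L m (λ s → ∣ prodV f s - prodV g s ∣) ⟩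
    ∑[ a ∈ L ] ∑[ s ∈ Ls ] ∣ f a * prodV f s - g a * prodV g s ∣
      ≤⟨ ∑-mono-≤ L (λ a → ∑-mono-≤ Ls (λ s →
           ∣ux-vy∣≤u∣x-y∣+∣u-v∣y (g a) (prodV f s) (nonNeg f-pmf a) (nonNeg (prodV-isPMF g-pmf m) s))) ⟩
    ∑[ a ∈ L ] ∑[ s ∈ Ls ] (f a * ∣ prodV f s - prodV g s ∣ + ∣ f a - g a ∣ * prodV g s)
      ≡⟨ ∑-∑-*-+ L Ls f (λ s → ∣ prodV f s - prodV g s ∣) (λ a s → ∣ f a - g a ∣ * prodV g s) ⟩
    ∑ L f * ℓ₁ Ls (prodV f) (prodV g) + ∑[ a ∈ L ] ∑[ s ∈ Ls ] (∣ f a - g a ∣ * prodV g s)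
      ≡⟨ cong₂ _+_ (trans (cong (_* ℓ₁ Ls (prodV f) (prodV g)) (total f-pmf)) (ℚ.*-identityˡ (ℓ₁ Ls (prodV f) (prodV g))))
                   (∑-cong L weight-by-prodV-g) ⟩
    ℓ₁ Ls (prodV f) (prodV g) + ℓ₁ L f g
      ∎
    where
    open ℚ.≤-Reasoning
    open IsPMF
    Ls = allVec L m
    weight-by-prodV-g : ∀ a → ∑[ s ∈ Ls ] (∣ f a - g a ∣ * prodV g s) ≡ ∣ f a - g a ∣
    weight-by-prodV-g a = begin-equality
      ∑[ s ∈ Ls ] (∣ f a - g a ∣ * prodV g s)   ≡⟨ *-distribˡ-∑ ∣ f a - g a ∣ Ls (prodV g) ⟨
      ∣ f a - g a ∣ * ∑ Ls (prodV g)            ≡⟨ cong (∣ f a - g a ∣ *_) (total (prodV-isPMF g-pmf m)) ⟩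
      ∣ f a - g a ∣ * 1ℚ                        ≡⟨ ℚ.*-identityʳ ∣ f a - g a ∣ ⟩
      ∣ f a - g a ∣                             ∎

  ℓ₁-prodV≤ : ∀ {f g} → IsPMF L f → IsPMF L g → ∀ m →
              ℓ₁ (allVec L m) (prodV f) (prodV g) ≤ ℕ→ℚ m * ℓ₁ L f g
  ℓ₁-prodV≤ {f} {g} f-pmf g-pmf zero    = ℚ.≤-reflexive (sym (ℚ.*-zeroˡ (ℓ₁ L f g)))
  ℓ₁-prodV≤ {f} {g} f-pmf g-pmf (suc m) = begin
    ℓ₁ (allVec L (suc m)) (prodV f) (prodV g)        ≤⟨ ℓ₁-prodV-suc≤ f-pmf g-pmf m ⟩
    ℓ₁ (allVec L m) (prodV f) (prodV g) + ℓ₁ L f g   ≤⟨ ℚ.+-monoˡ-≤ (ℓ₁ L f g) (ℓ₁-prodV≤ f-pmf g-pmf m) ⟩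
    ℕ→ℚ m * ℓ₁ L f g + ℓ₁ L f g                      ≡⟨ n*δ+δ (ℕ→ℚ m) (ℓ₁ L f g) ⟩
    (1ℚ + ℕ→ℚ m) * ℓ₁ L f g                          ≡⟨ cong (_* ℓ₁ L f g) (ℕ→ℚ-+ 1 m) ⟨
    ℕ→ℚ (suc m) * ℓ₁ L f g                           ∎
    where
    open ℚ.≤-Reasoning
    n*δ+δ : ∀ n δ → n * δ + δ ≡ (1ℚ + n) * δ
    n*δ+δ = solve-∀ ℚ-ring

-- The enumeration used by Dmixed, so that avg (4 * k) unfolds to its uniform mixture.
bools : List Bool
bools = false ∷ true ∷ []

avg : ∀ n → (Vec Bool n → ℚ) → ℚ
avg n G = pow ½ n * ∑ (allVec bools n) G

flipAt : ∀ {n} → Fin n → Vec Bool n → Vec Bool n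
flipAt i b = updateAt b i not

OddUnder : ∀ {n} → Fin n → (Vec Bool n → ℚ) → Set
OddUnder i d = ∀ b → d (flipAt i b) ≡ - d b

pow½-nonNeg : ∀ n → 0ℚ ≤ pow ½ n
pow½-nonNeg zero    = ℚ.nonNegative⁻¹ 1ℚ
pow½-nonNeg (suc n) = 0≤-* (ℚ.nonNegative⁻¹ ½) (pow½-nonNeg n)

avg-suc : ∀ n G → avg (suc n) G ≡ ½ * (avg n (G ∘ (false ∷_)) + avg n (G ∘ (true ∷_)))
avg-suc n G = trans (cong (pow ½ (suc n) *_) (∑-allVec-suc bools n G))
                    (regroup (pow ½ n) (∑ (allVec bools n) (G ∘ (false ∷_))) (∑ (allVec bools n) (G ∘ (true ∷_))))
  where
  regroup : ∀ c x y → (½ * c) * (x + (y + 0ℚ)) ≡ ½ * (c * x + c * y)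
  regroup = solve-∀ ℚ-ring

avg-cong : ∀ n {F G} → (∀ b → F b ≡ G b) → avg n F ≡ avg n G
avg-cong n F≗G = cong (pow ½ n *_) (∑-cong (allVec bools n) F≗G)

avg-mono-≤ : ∀ n {F G} → (∀ b → F b ≤ G b) → avg n F ≤ avg n G
avg-mono-≤ n F≤G = *-monoˡ-≤-0≤ (pow½-nonNeg n) (∑-mono-≤ (allVec bools n) F≤G)

avg-distrib-+ : ∀ n F G → avg n (λ b → F b + G b) ≡ avg n F + avg n G
avg-distrib-+ n F G = trans (cong (pow ½ n *_) (∑-distrib-+ (allVec bools n) F G))
                            (ℚ.*-distribˡ-+ (pow ½ n) (∑ (allVec bools n) F) (∑ (allVec bools n) G))

*-distribˡ-avg : ∀ n c F → c * avg n F ≡ avg n (λ b → c * F b)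
*-distribˡ-avg n c F = trans (swap c (pow ½ n) (∑ (allVec bools n) F))
                             (cong (pow ½ n *_) (*-distribˡ-∑ c (allVec bools n) F))
  where
  swap : ∀ c p s → c * (p * s) ≡ p * (c * s)
  swap = solve-∀ ℚ-ring

∣avg∣≤avg∣∣ : ∀ n F → ∣ avg n F ∣ ≤ avg n (λ b → ∣ F b ∣)
∣avg∣≤avg∣∣ n F = ℚ.≤-trans (ℚ.≤-reflexive (∣r*p∣≡r*∣p∣ (∑ (allVec bools n) F) (pow½-nonNeg n)))
                            (*-monoˡ-≤-0≤ (pow½-nonNeg n) (∣∑∣≤∑∣∣ (allVec bools n) F))

avg-const : ∀ n c → avg n (λ _ → c) ≡ c
avg-const zero    c = trans (ℚ.*-identityˡ (c + 0ℚ)) (ℚ.+-identityʳ c)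
avg-const (suc n) c = trans (avg-suc n (λ _ → c)) (trans (cong (λ a → ½ * (a + a)) (avg-const n c)) (half-double c))
  where
  half-double : ∀ c → ½ * (c + c) ≡ c
  half-double = solve-∀ ℚ-ring

∑-avg-comm : ∀ n (xs : List A) (G : A → Vec Bool n → ℚ) →
             ∑[ x ∈ xs ] avg n (G x) ≡ avg n (λ b → ∑[ x ∈ xs ] G x b)
∑-avg-comm n xs G = trans (sym (*-distribˡ-∑ (pow ½ n) xs (λ x → ∑ (allVec bools n) (G x))))
                          (cong (pow ½ n *_) (∑-comm xs (allVec bools n) G))

avg-flipAt : ∀ n (i : Fin n) G → avg n (G ∘ flipAt i) ≡ avg n G
avg-flipAt (suc n) zero    G = begin
  avg (suc n) (G ∘ flipAt zero)
    ≡⟨ avg-suc n (G ∘ flipAt zero) ⟩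
  ½ * (avg n (G ∘ (true ∷_)) + avg n (G ∘ (false ∷_)))
    ≡⟨ cong (½ *_) (ℚ.+-comm (avg n (G ∘ (true ∷_))) (avg n (G ∘ (false ∷_)))) ⟩
  ½ * (avg n (G ∘ (false ∷_)) + avg n (G ∘ (true ∷_)))
    ≡⟨ avg-suc n G ⟨
  avg (suc n) G
    ∎
  where open ≡-Reasoning
avg-flipAt (suc n) (suc i) G = begin
  avg (suc n) (G ∘ flipAt (suc i))
    ≡⟨ avg-suc n (G ∘ flipAt (suc i)) ⟩
  ½ * (avg n (G ∘ (false ∷_) ∘ flipAt i) + avg n (G ∘ (true ∷_) ∘ flipAt i))
    ≡⟨ cong₂ (λ x y → ½ * (x + y)) (avg-flipAt n i (G ∘ (false ∷_))) (avg-flipAt n i (G ∘ (true ∷_))) ⟩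
  ½ * (avg n (G ∘ (false ∷_)) + avg n (G ∘ (true ∷_)))
    ≡⟨ avg-suc n G ⟨
  avg (suc n) G
    ∎
  where open ≡-Reasoning

∣avg-odd*∣≤ : ∀ n (i : Fin n) {d : Vec Bool n → ℚ} {c} (F : Vec Bool n → ℚ) → OddUnder i d → (∀ b → ∣ d b ∣ ≤ c) →
              ∣ avg n (λ b → d b * F b) ∣ ≤ ½ * (c * avg n (λ b → ∣ F b - F (flipAt i b) ∣))
∣avg-odd*∣≤ n i {d} {c} F odd ∣d∣≤c = begin
  ∣ avg n dF ∣
    ≡⟨ cong ∣_∣ (half-double (avg n dF)) ⟩
  ∣ ½ * (avg n dF + avg n dF) ∣
    ≡⟨ cong (λ x → ∣ ½ * (avg n dF + x) ∣) (trans (sym (avg-flipAt n i dF)) (avg-cong n flip-odd)) ⟩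
  ∣ ½ * (avg n dF + avg n (λ b → - d b * F (flipAt i b))) ∣
    ≡⟨ cong (λ x → ∣ ½ * x ∣) (trans (sym (avg-distrib-+ n dF (λ b → - d b * F (flipAt i b)))) (avg-cong n pair-up)) ⟩
  ∣ ½ * avg n (λ b → d b * ΔF b) ∣
    ≡⟨ ∣r*p∣≡r*∣p∣ (avg n (λ b → d b * ΔF b)) (ℚ.nonNegative⁻¹ ½) ⟩
  ½ * ∣ avg n (λ b → d b * ΔF b) ∣
    ≤⟨ *-monoˡ-≤-0≤ (ℚ.nonNegative⁻¹ ½) (ℚ.≤-trans (∣avg∣≤avg∣∣ n (λ b → d b * ΔF b)) (avg-mono-≤ n ∣d*ΔF∣≤c*∣ΔF∣)) ⟩
  ½ * avg n (λ b → c * ∣ ΔF b ∣)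
    ≡⟨ cong (½ *_) (*-distribˡ-avg n c (λ b → ∣ ΔF b ∣)) ⟨
  ½ * (c * avg n (λ b → ∣ ΔF b ∣))
    ∎
  where
  open ℚ.≤-Reasoning
  dF ΔF : Vec Bool n → ℚ
  dF b = d b * F b
  ΔF b = F b - F (flipAt i b)
  half-double : ∀ x → x ≡ ½ * (x + x)
  half-double = solve-∀ ℚ-ring
  flip-odd : ∀ b → dF (flipAt i b) ≡ - d b * F (flipAt i b)
  flip-odd b = cong (_* F (flipAt i b)) (odd b)
  factor : ∀ d x y → d * x + - d * y ≡ d * (x - y)
  factor = solve-∀ ℚ-ring
  pair-up : ∀ b → dF b + - d b * F (flipAt i b) ≡ d b * ΔF b
  pair-up b = factor (d b) (F b) (F (flipAt i b))
  ∣d*ΔF∣≤c*∣ΔF∣ : ∀ b → ∣ d b * ΔF b ∣ ≤ c * ∣ ΔF b ∣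
  ∣d*ΔF∣≤c*∣ΔF∣ b = ℚ.≤-trans (ℚ.≤-reflexive (ℚ.∣p*q∣≡∣p∣*∣q∣ (d b) (ΔF b))) (*-monoʳ-≤-0≤ (ℚ.0≤∣p∣ (ΔF b)) (∣d∣≤c b))

module ProductMixture {L : List A} {n : ℕ} (w : A → ℚ) (q : Vec Bool n → A → ℚ) where

  mixture : ∀ {m} → Vec A m → ℚ
  mixture s = avg n (λ b → prodV (q b) s)

  gap : ℕ → ℚ
  gap m = ℓ₁ (allVec L m) (prodV w) mixture

  drift : A → ∀ {m} → Vec A m → ℚ
  drift a s = avg n (λ b → (q b a - w a) * prodV (q b) s)

  gap-zero : gap 0 ≡ 0ℚ
  gap-zero = cong (λ x → ∣ 1ℚ - x ∣ + 0ℚ) (avg-const n 1ℚ)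

  mixture-cons : ∀ a {m} (s : Vec A m) → mixture (a ∷ s) ≡ w a * mixture s + drift a s
  mixture-cons a s = begin
    avg n (λ b → q b a * prodV (q b) s)
      ≡⟨ avg-cong n (λ b → split (q b a) (w a) (prodV (q b) s)) ⟩
    avg n (λ b → w a * prodV (q b) s + (q b a - w a) * prodV (q b) s)
      ≡⟨ avg-distrib-+ n (λ b → w a * prodV (q b) s) (λ b → (q b a - w a) * prodV (q b) s) ⟩
    avg n (λ b → w a * prodV (q b) s) + drift a s
      ≡⟨ cong (_+ drift a s) (*-distribˡ-avg n (w a) (λ b → prodV (q b) s)) ⟨
    w a * mixture s + drift a s
      ∎
    where
    open ≡-Reasoning
    split : ∀ v u x → v * x ≡ u * x + (v - u) * x
    split = solve-∀ ℚ-ring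

  gap-suc≤ : IsPMF L w → ∀ m → gap (suc m) ≤ gap m + ∑[ a ∈ L ] ∑[ s ∈ allVec L m ] ∣ drift a s ∣
  gap-suc≤ w-pmf m = begin
    gap (suc m)
      ≡⟨ ∑-allVec-suc L m (λ s → ∣ prodV w s - mixture s ∣) ⟩
    ∑[ a ∈ L ] ∑[ s ∈ Ls ] ∣ w a * prodV w s - mixture (a ∷ s) ∣
      ≡⟨ ∑-cong L (λ a → ∑-cong Ls (λ s → cong (λ x → ∣ w a * prodV w s - x ∣) (mixture-cons a s))) ⟩
    ∑[ a ∈ L ] ∑[ s ∈ Ls ] ∣ w a * prodV w s - (w a * mixture s + drift a s) ∣
      ≤⟨ ∑-mono-≤ L (λ a → ∑-mono-≤ Ls (λ s →
           ∣ux-[uy+t]∣≤u∣x-y∣+∣t∣ (prodV w s) (mixture s) (drift a s) (nonNeg a))) ⟩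
    ∑[ a ∈ L ] ∑[ s ∈ Ls ] (w a * ∣ prodV w s - mixture s ∣ + ∣ drift a s ∣)
      ≡⟨ ∑-∑-*-+ L Ls w (λ s → ∣ prodV w s - mixture s ∣) (λ a s → ∣ drift a s ∣) ⟩
    ∑ L w * gap m + ∑[ a ∈ L ] ∑[ s ∈ Ls ] ∣ drift a s ∣
      ≡⟨ cong (_+ ∑[ a ∈ L ] ∑[ s ∈ Ls ] ∣ drift a s ∣) (trans (cong (_* gap m) total) (ℚ.*-identityˡ (gap m))) ⟩
    gap m + ∑[ a ∈ L ] ∑[ s ∈ Ls ] ∣ drift a s ∣
      ∎
    where
    open ℚ.≤-Reasoning
    open IsPMF w-pmf
    Ls = allVec L m

  drift-vanishes : ∀ a → (∀ b → q b a ≡ w a) → ∀ {m} (s : Vec A m) → drift a s ≡ 0ℚ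
  drift-vanishes a q≡w s = trans (avg-cong n weight≡0) (avg-const n 0ℚ)
    where
    weight≡0 : ∀ b → (q b a - w a) * prodV (q b) s ≡ 0ℚ
    weight≡0 b = begin
      (q b a - w a) * prodV (q b) s   ≡⟨ cong (λ x → (x - w a) * prodV (q b) s) (q≡w b) ⟩
      (w a - w a) * prodV (q b) s     ≡⟨ cong (_* prodV (q b) s) (ℚ.+-inverseʳ (w a)) ⟩
      0ℚ * prodV (q b) s              ≡⟨ ℚ.*-zeroˡ (prodV (q b) s) ⟩
      0ℚ                              ∎
      where open ≡-Reasoning

  ∑∣drift∣-odd≤ : (∀ b → IsPMF L (q b)) → ∀ a (i : Fin n) {c δ} → OddUnder i (λ b → q b a - w a) →
                  (∀ b → ∣ q b a - w a ∣ ≤ c) → (∀ b → ℓ₁ L (q b) (q (flipAt i b)) ≤ δ) →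
                  ∀ m → ∑[ s ∈ allVec L m ] ∣ drift a s ∣ ≤ ½ * (c * (ℕ→ℚ m * δ))
  ∑∣drift∣-odd≤ q-pmf a i {c} {δ} odd dev≤c ℓ₁≤δ m = begin
    ∑[ s ∈ Ls ] ∣ drift a s ∣
      ≤⟨ ∑-mono-≤ Ls (λ s → ∣avg-odd*∣≤ n i (λ b → prodV (q b) s) odd dev≤c) ⟩
    ∑[ s ∈ Ls ] (½ * (c * avg n (Δ s)))
      ≡⟨ *-distribˡ-∑ ½ Ls (λ s → c * avg n (Δ s)) ⟨
    ½ * ∑[ s ∈ Ls ] (c * avg n (Δ s))
      ≡⟨ cong (½ *_) (*-distribˡ-∑ c Ls (λ s → avg n (Δ s))) ⟨
    ½ * (c * ∑[ s ∈ Ls ] avg n (Δ s))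
      ≡⟨ cong (λ x → ½ * (c * x)) (∑-avg-comm n Ls Δ) ⟩
    ½ * (c * avg n (λ b → ℓ₁ Ls (prodV (q b)) (prodV (q (flipAt i b)))))
      ≤⟨ *-monoˡ-≤-0≤ (ℚ.nonNegative⁻¹ ½) (*-monoˡ-≤-0≤ 0≤c (avg-mono-≤ n ℓ₁-prodV-flipAt≤)) ⟩
    ½ * (c * avg n (λ _ → ℕ→ℚ m * δ))
      ≡⟨ cong (λ x → ½ * (c * x)) (avg-const n (ℕ→ℚ m * δ)) ⟩
    ½ * (c * (ℕ→ℚ m * δ))
      ∎
    where
    open ℚ.≤-Reasoning
    Ls = allVec L m
    Δ : Vec A m → Vec Bool n → ℚ
    Δ s b = ∣ prodV (q b) s - prodV (q (flipAt i b)) s ∣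
    0≤c : 0ℚ ≤ c
    0≤c = ℚ.≤-trans (ℚ.0≤∣p∣ (q (replicate n false) a - w a)) (dev≤c (replicate n false))
    ℓ₁-prodV-flipAt≤ : ∀ b → ℓ₁ Ls (prodV (q b)) (prodV (q (flipAt i b))) ≤ ℕ→ℚ m * δ
    ℓ₁-prodV-flipAt≤ b = ℚ.≤-trans (ℓ₁-prodV≤ (q-pmf b) (q-pmf (flipAt i b)) m) (*-monoˡ-≤-0≤ (ℕ→ℚ-nonNeg m) (ℓ₁≤δ b))

∑-allXY : ∀ k (f : Pt k × Bool → ℚ) → ∑ (allXY k) f ≡ ∑[ x ∈ allPt k ] ∑[ y ∈ bools ] f (x , y)
∑-allXY k f = ∑-concatMap (λ x → (x , false) ∷ (x , true) ∷ []) (allPt k) f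

∑-allPt : ∀ k (g : Pt k → ℚ) → ∑ (allPt k) g ≡ g bot + (g xminus + (g xplus + ∑[ i ∈ allFin (4 ℕ.* k) ] g (xi i)))
∑-allPt k g = cong (λ z → g bot + (g xminus + (g xplus + z))) (∑-map xi (allFin (4 ℕ.* k)) g)

∑-allPt-xi : ∀ k (g : Pt k → ℚ) → g bot ≡ 0ℚ → g xminus ≡ 0ℚ → g xplus ≡ 0ℚ →
             ∑ (allPt k) g ≡ ∑[ i ∈ allFin (4 ℕ.* k) ] g (xi i)
∑-allPt-xi k g g⊥≡0 g⁻≡0 g⁺≡0 = begin
  ∑ (allPt k) g                           ≡⟨ ∑-allPt k g ⟩
  g bot + (g xminus + (g xplus + Σxi))    ≡⟨ cong₂ _+_ g⊥≡0 (cong₂ _+_ g⁻≡0 (cong (_+ Σxi) g⁺≡0)) ⟩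
  0ℚ + (0ℚ + (0ℚ + Σxi))                  ≡⟨ drop-zeros Σxi ⟩
  Σxi                                     ∎
  where
  open ≡-Reasoning
  Σxi = ∑[ i ∈ allFin (4 ℕ.* k) ] g (xi i)
  drop-zeros : ∀ x → 0ℚ + (0ℚ + (0ℚ + x)) ≡ x
  drop-zeros = solve-∀ ℚ-ring

∑-bools-∣p-p∣ : ∀ (f : Bool → ℚ) → ∑[ y ∈ bools ] ∣ f y - f y ∣ ≡ 0ℚ
∑-bools-∣p-p∣ f = trans (∑-cong bools (λ y → ∣p-p∣≡0 (f y))) (∑-zero bools)

condProb-½-nonNeg : ∀ y → 0ℚ ≤ condProb ½ y
condProb-½-nonNeg false = ℚ.nonNegative⁻¹ (1ℚ - ½)
condProb-½-nonNeg true  = ℚ.nonNegative⁻¹ ½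

condProb-bit-nonNeg : ∀ c y → 0ℚ ≤ condProb (bit c) y
condProb-bit-nonNeg false false = ℚ.nonNegative⁻¹ 1ℚ
condProb-bit-nonNeg false true  = ℚ.≤-refl
condProb-bit-nonNeg true  false = ℚ.≤-refl
condProb-bit-nonNeg true  true  = ℚ.nonNegative⁻¹ 1ℚ

bit-dev : Bool → Bool → ℚ
bit-dev c y = condProb (bit c) y - condProb ½ y

bit-dev-not : ∀ c y → bit-dev (not c) y ≡ - bit-dev c y
bit-dev-not false false = refl
bit-dev-not false true  = refl
bit-dev-not true  false = refl
bit-dev-not true  true  = refl

∣bit-dev∣ : ∀ c y → ∣ bit-dev c y ∣ ≡ ½
∣bit-dev∣ false false = refl
∣bit-dev∣ false true  = refl
∣bit-dev∣ true  false = refl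
∣bit-dev∣ true  true  = refl

∣condProb-bit-not∣ : ∀ c y → ∣ condProb (bit c) y - condProb (bit (not c)) y ∣ ≡ 1ℚ
∣condProb-bit-not∣ false false = refl
∣condProb-bit-not∣ false true  = refl
∣condProb-bit-not∣ true  false = refl
∣condProb-bit-not∣ true  true  = refl

module Construction (k′ : ℕ) (γ : ℚ) (0≤γ : 0ℚ ≤ γ) (γ≤1 : γ ≤ 1ℚ) where

  k N : ℕ
  k = suc k′
  N = 4 ℕ.* k

  p : ℚ
  p = γ * inv (8 ℕ.* k)

  0≤p : 0ℚ ≤ p
  0≤p = 0≤-* 0≤γ (ℚ.nonNegative⁻¹ (inv (8 ℕ.* k)) {{ℚ.normalize-nonNeg 1 (8 ℕ.* k)}})

  8k*inv8k : ℕ→ℚ 8 * ℕ→ℚ k * inv (8 ℕ.* k) ≡ 1ℚ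
  8k*inv8k = trans (cong (_* inv (8 ℕ.* k)) (sym (ℕ→ℚ-* 8 k))) (ℕ→ℚ*inv (8 ℕ.* k))

  32k*inv32k : ℕ→ℚ 32 * ℕ→ℚ k * inv (32 ℕ.* k) ≡ 1ℚ
  32k*inv32k = trans (cong (_* inv (32 ℕ.* k)) (sym (ℕ→ℚ-* 32 k))) (ℕ→ℚ*inv (32 ℕ.* k))

  N*inv8k : ℕ→ℚ N * inv (8 ℕ.* k) ≡ ½
  N*inv8k = begin
    ℕ→ℚ N * inv (8 ℕ.* k)                 ≡⟨ cong (_* inv (8 ℕ.* k)) (ℕ→ℚ-* 4 k) ⟩
    ℕ→ℚ 4 * ℕ→ℚ k * inv (8 ℕ.* k)         ≡⟨ halve (ℕ→ℚ k) (inv (8 ℕ.* k)) ⟩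
    ½ * (ℕ→ℚ 8 * ℕ→ℚ k * inv (8 ℕ.* k))   ≡⟨ cong (½ *_) 8k*inv8k ⟩
    ½ * 1ℚ                                ≡⟨ ℚ.*-identityʳ ½ ⟩
    ½                                     ∎
    where
    open ≡-Reasoning
    halve : ∀ K I → ℕ→ℚ 4 * K * I ≡ ½ * (ℕ→ℚ 8 * K * I)
    halve = solve-∀ ℚ-ring

  inv32k≡¼*inv8k : inv (32 ℕ.* k) ≡ inv 4 * inv (8 ℕ.* k)
  inv32k≡¼*inv8k = begin
    J                              ≡⟨ ℚ.*-identityʳ J ⟨
    J * 1ℚ                         ≡⟨ cong (J *_) 8k*inv8k ⟨
    J * (ℕ→ℚ 8 * K * I)            ≡⟨ regroup J K I ⟩
    inv 4 * I * (ℕ→ℚ 32 * K * J)   ≡⟨ cong (inv 4 * I *_) 32k*inv32k ⟩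
    inv 4 * I * 1ℚ                 ≡⟨ ℚ.*-identityʳ (inv 4 * I) ⟩
    inv 4 * I                      ∎
    where
    open ≡-Reasoning
    K = ℕ→ℚ k
    I = inv (8 ℕ.* k)
    J = inv (32 ℕ.* k)
    regroup : ∀ J K I → J * (ℕ→ℚ 8 * K * I) ≡ inv 4 * I * (ℕ→ℚ 32 * K * J)
    regroup = solve-∀ ℚ-ring

  Dx-isPMF : IsPMF (allPt k) (Dx k γ)
  Dx-isPMF = record { nonNeg = Dx-nonNeg ; total = Dx-total }
    where
    Dx-nonNeg : ∀ x → 0ℚ ≤ Dx k γ x
    Dx-nonNeg bot    = p≤q⇒0≤q-p γ≤1
    Dx-nonNeg xminus = 0≤-* 0≤γ (ℚ.nonNegative⁻¹ (inv 4))
    Dx-nonNeg xplus  = 0≤-* 0≤γ (ℚ.nonNegative⁻¹ (inv 4))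
    Dx-nonNeg (xi i) = 0≤p
    Dx-total : ∑ (allPt k) (Dx k γ) ≡ 1ℚ
    Dx-total = begin
      ∑ (allPt k) (Dx k γ)
        ≡⟨ ∑-allPt k (Dx k γ) ⟩
      (1ℚ - γ) + (γ * inv 4 + (γ * inv 4 + ∑[ i ∈ allFin N ] p))
        ≡⟨ cong (λ z → (1ℚ - γ) + (γ * inv 4 + (γ * inv 4 + z))) (∑-allFin-const N p) ⟩
      (1ℚ - γ) + (γ * inv 4 + (γ * inv 4 + ℕ→ℚ N * (γ * inv (8 ℕ.* k))))
        ≡⟨ regroup γ (ℕ→ℚ N) (inv (8 ℕ.* k)) ⟩
      (1ℚ - γ) + γ * (inv 4 + (inv 4 + ℕ→ℚ N * inv (8 ℕ.* k)))
        ≡⟨ cong (λ z → (1ℚ - γ) + γ * (inv 4 + (inv 4 + z))) N*inv8k ⟩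
      (1ℚ - γ) + γ * (inv 4 + (inv 4 + ½))
        ≡⟨ masses-add-up γ ⟩
      1ℚ
        ∎
      where
      open ≡-Reasoning
      regroup : ∀ γ n i → (1ℚ - γ) + (γ * inv 4 + (γ * inv 4 + n * (γ * i))) ≡ (1ℚ - γ) + γ * (inv 4 + (inv 4 + n * i))
      regroup = solve-∀ ℚ-ring
      masses-add-up : ∀ γ → (1ℚ - γ) + γ * (inv 4 + (inv 4 + ½)) ≡ 1ℚ
      masses-add-up = solve-∀ ℚ-ring

  D1-isPMF : ∀ {μ} → (∀ x y → 0ℚ ≤ condProb (μ x) y) → IsPMF (allXY k) (D1 k γ μ)
  D1-isPMF {μ} condProb-nonNeg = record { nonNeg = D1-nonNeg ; total = D1-total }
    where
    open IsPMF Dx-isPMF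
    D1-nonNeg : ∀ a → 0ℚ ≤ D1 k γ μ a
    D1-nonNeg (x , y) = 0≤-* (nonNeg x) (condProb-nonNeg x y)
    marginalise : ∀ d u → d * (1ℚ - u) + (d * u + 0ℚ) ≡ d
    marginalise = solve-∀ ℚ-ring
    D1-total : ∑ (allXY k) (D1 k γ μ) ≡ 1ℚ
    D1-total = trans (∑-allXY k (D1 k γ μ)) (trans (∑-cong (allPt k) (λ x → marginalise (Dx k γ x) (μ x))) total)

  w : Pt k × Bool → ℚ
  w = D1 k γ (μpure k)

  q : Vec Bool N → Pt k × Bool → ℚ
  q b = D1 k γ (μmixed k b)

  w-isPMF : IsPMF (allXY k) w
  w-isPMF = D1-isPMF (λ _ → condProb-½-nonNeg)

  q-isPMF : ∀ b → IsPMF (allXY k) (q b)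
  q-isPMF b = D1-isPMF mixed-nonNeg
    where
    mixed-nonNeg : ∀ x y → 0ℚ ≤ condProb (μmixed k b x) y
    mixed-nonNeg bot    = condProb-½-nonNeg
    mixed-nonNeg xminus = condProb-½-nonNeg
    mixed-nonNeg xplus  = condProb-½-nonNeg
    mixed-nonNeg (xi i) = condProb-bit-nonNeg (lookup b i)

  q-w-xi : ∀ b i y → q b (xi i , y) - w (xi i , y) ≡ p * bit-dev (lookup b i) y
  q-w-xi b i y = sym (*-distribˡ-minus p (condProb (bit (lookup b i)) y) (condProb ½ y))

  q-w-xi-odd : ∀ i y → OddUnder i (λ b → q b (xi i , y) - w (xi i , y))
  q-w-xi-odd i y b = begin
    q (flipAt i b) (xi i , y) - w (xi i , y)   ≡⟨ q-w-xi (flipAt i b) i y ⟩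
    p * bit-dev (lookup (flipAt i b) i) y      ≡⟨ cong (λ c → p * bit-dev c y) (Vec.lookup∘updateAt i b) ⟩
    p * bit-dev (not (lookup b i)) y           ≡⟨ cong (p *_) (bit-dev-not (lookup b i) y) ⟩
    p * - bit-dev (lookup b i) y               ≡⟨ ℚ.neg-distribʳ-* p (bit-dev (lookup b i) y) ⟨
    - (p * bit-dev (lookup b i) y)             ≡⟨ cong -_ (q-w-xi b i y) ⟨
    - (q b (xi i , y) - w (xi i , y))          ∎
    where open ≡-Reasoning

  ∣q-w-xi∣ : ∀ b i y → ∣ q b (xi i , y) - w (xi i , y) ∣ ≡ p * ½
  ∣q-w-xi∣ b i y = begin
    ∣ q b (xi i , y) - w (xi i , y) ∣     ≡⟨ cong ∣_∣ (q-w-xi b i y) ⟩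
    ∣ p * bit-dev (lookup b i) y ∣        ≡⟨ ∣r*p∣≡r*∣p∣ (bit-dev (lookup b i) y) 0≤p ⟩
    p * ∣ bit-dev (lookup b i) y ∣        ≡⟨ cong (p *_) (∣bit-dev∣ (lookup b i) y) ⟩
    p * ½                                 ∎
    where open ≡-Reasoning

  ℓ₁-q-flipAt : ∀ b i → ℓ₁ (allXY k) (q b) (q (flipAt i b)) ≡ p + p
  ℓ₁-q-flipAt b i = begin
    ℓ₁ (allXY k) (q b) (q (flipAt i b))
      ≡⟨ ∑-allXY k (λ a → ∣ q b a - q (flipAt i b) a ∣) ⟩
    ∑ (allPt k) dist
      ≡⟨ ∑-allPt-xi k dist (∑-bools-∣p-p∣ (w ∘ (bot ,_))) (∑-bools-∣p-p∣ (w ∘ (xminus ,_)))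
                           (∑-bools-∣p-p∣ (w ∘ (xplus ,_))) ⟩
    ∑ (allFin N) (dist ∘ xi)
      ≡⟨ ∑-allFin-single i (dist ∘ xi) unflipped ⟩
    dist (xi i)
      ≡⟨ cong₂ (λ u v → u + (v + 0ℚ)) (flipped false) (flipped true) ⟩
    p * 1ℚ + (p * 1ℚ + 0ℚ)
      ≡⟨ double p ⟩
    p + p
      ∎
    where
    open ≡-Reasoning
    dist : Pt k → ℚ
    dist x = ∑[ y ∈ bools ] ∣ q b (x , y) - q (flipAt i b) (x , y) ∣
    unflipped : ∀ j → ¬ j ≡ i → dist (xi j) ≡ 0ℚ
    unflipped j j≢i = trans (cong (λ c → ∑[ y ∈ bools ] ∣ p * condProb (bit (lookup b j)) y - p * condProb (bit c) y ∣)
                                  (Vec.lookup∘updateAt′ j i j≢i b))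
                            (∑-bools-∣p-p∣ (λ y → p * condProb (bit (lookup b j)) y))
    flipped : ∀ y → ∣ q b (xi i , y) - q (flipAt i b) (xi i , y) ∣ ≡ p * 1ℚ
    flipped y = begin
      ∣ p * condProb (bit c) y - p * condProb (bit (lookup (flipAt i b) i)) y ∣
        ≡⟨ cong (λ c′ → ∣ p * condProb (bit c) y - p * condProb (bit c′) y ∣) (Vec.lookup∘updateAt i b) ⟩
      ∣ p * condProb (bit c) y - p * condProb (bit (not c)) y ∣
        ≡⟨ cong ∣_∣ (*-distribˡ-minus p (condProb (bit c) y) (condProb (bit (not c)) y)) ⟨
      ∣ p * (condProb (bit c) y - condProb (bit (not c)) y) ∣
        ≡⟨ ∣r*p∣≡r*∣p∣ (condProb (bit c) y - condProb (bit (not c)) y) 0≤p ⟩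
      p * ∣ condProb (bit c) y - condProb (bit (not c)) y ∣
        ≡⟨ cong (p *_) (∣condProb-bit-not∣ c y) ⟩
      p * 1ℚ
        ∎
      where c = lookup b i
    double : ∀ p → p * 1ℚ + (p * 1ℚ + 0ℚ) ≡ p + p
    double = solve-∀ ℚ-ring

  open ProductMixture {L = allXY k} w q public

  H : ℚ
  H = ℕ→ℚ N * (p * p)

  ∑∣drift∣-unaffected : ∀ x → (∀ b y → q b (x , y) ≡ w (x , y)) → ∀ m →
                        ∑[ y ∈ bools ] ∑[ s ∈ allVec (allXY k) m ] ∣ drift (x , y) s ∣ ≡ 0ℚ
  ∑∣drift∣-unaffected x q≡w m = trans (∑-cong bools ∑∣drift∣≡0) (∑-zero bools)
    where
    Ls = allVec (allXY k) m
    ∑∣drift∣≡0 : ∀ y → ∑[ s ∈ Ls ] ∣ drift (x , y) s ∣ ≡ 0ℚ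
    ∑∣drift∣≡0 y = trans (∑-cong Ls (λ s → cong ∣_∣ (drift-vanishes (x , y) (λ b → q≡w b y) s))) (∑-zero Ls)

  ∑∣drift∣-xi≤ : ∀ i y m → ∑[ s ∈ allVec (allXY k) m ] ∣ drift (xi i , y) s ∣ ≤ ½ * ((p * ½) * (ℕ→ℚ m * (p + p)))
  ∑∣drift∣-xi≤ i y = ∑∣drift∣-odd≤ q-isPMF (xi i , y) i (q-w-xi-odd i y)
                       (λ b → ℚ.≤-reflexive (∣q-w-xi∣ b i y)) (λ b → ℚ.≤-reflexive (ℓ₁-q-flipAt b i))

  ∑∣drift∣≤ : ∀ m → ∑[ a ∈ allXY k ] ∑[ s ∈ allVec (allXY k) m ] ∣ drift a s ∣ ≤ ℕ→ℚ m * H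
  ∑∣drift∣≤ m = begin
    ∑[ a ∈ allXY k ] D a                 ≡⟨ ∑-allXY k D ⟩
    ∑ (allPt k) D₂                       ≡⟨ ∑-allPt-xi k D₂ (∑∣drift∣-unaffected bot (λ _ _ → refl) m)
                                              (∑∣drift∣-unaffected xminus (λ _ _ → refl) m)
                                              (∑∣drift∣-unaffected xplus (λ _ _ → refl) m) ⟩
    ∑ (allFin N) (D₂ ∘ xi)               ≤⟨ ∑-mono-≤ (allFin N) (λ i → ∑-mono-≤ bools (λ y → ∑∣drift∣-xi≤ i y m)) ⟩
    ∑[ i ∈ allFin N ] ∑[ y ∈ bools ] β   ≡⟨ ∑-allFin-const N (∑[ y ∈ bools ] β) ⟩
    ℕ→ℚ N * (β + (β + 0ℚ))               ≡⟨ collect (ℕ→ℚ N) p (ℕ→ℚ m) ⟩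
    ℕ→ℚ m * H                            ∎
    where
    open ℚ.≤-Reasoning
    D : Pt k × Bool → ℚ
    D a = ∑[ s ∈ allVec (allXY k) m ] ∣ drift a s ∣
    D₂ : Pt k → ℚ
    D₂ x = ∑[ y ∈ bools ] D (x , y)
    β : ℚ
    β = ½ * ((p * ½) * (ℕ→ℚ m * (p + p)))
    collect : ∀ n p m → n * (½ * ((p * ½) * (m * (p + p))) + (½ * ((p * ½) * (m * (p + p))) + 0ℚ)) ≡ m * (n * (p * p))
    collect = solve-∀ ℚ-ring

  gap≤ : ∀ m → gap m ≤ ℕ→ℚ (m ℕ.* m) * H
  gap≤ = quadratic-growth gap (0≤-* (ℕ→ℚ-nonNeg N) (0≤-* 0≤p 0≤p)) gap-zero
           (λ m → ℚ.≤-trans (gap-suc≤ w-isPMF m) (ℚ.+-monoʳ-≤ (gap m) (∑∣drift∣≤ m)))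

  ½*m²*H≡ : ∀ m → ½ * (ℕ→ℚ (m ℕ.* m) * H) ≡ ℕ→ℚ (m ℕ.* m) * γ * γ * inv (32 ℕ.* k)
  ½*m²*H≡ m = begin
    ½ * (M * (ℕ→ℚ N * (γ * I * (γ * I))))       ≡⟨ cong (λ n → ½ * (M * (n * (γ * I * (γ * I))))) (ℕ→ℚ-* 4 k) ⟩
    ½ * (M * (ℕ→ℚ 4 * K * (γ * I * (γ * I))))   ≡⟨ regroup M K γ I ⟩
    M * γ * γ * (inv 4 * I) * (ℕ→ℚ 8 * K * I)   ≡⟨ cong (M * γ * γ * (inv 4 * I) *_) 8k*inv8k ⟩
    M * γ * γ * (inv 4 * I) * 1ℚ                ≡⟨ ℚ.*-identityʳ (M * γ * γ * (inv 4 * I)) ⟩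
    M * γ * γ * (inv 4 * I)                     ≡⟨ cong (M * γ * γ *_) inv32k≡¼*inv8k ⟨
    M * γ * γ * inv (32 ℕ.* k)                  ∎
    where
    open ≡-Reasoning
    M = ℕ→ℚ (m ℕ.* m)
    K = ℕ→ℚ k
    I = inv (8 ℕ.* k)
    regroup : ∀ M K γ I → ½ * (M * (ℕ→ℚ 4 * K * (γ * I * (γ * I)))) ≡ M * γ * γ * (inv 4 * I) * (ℕ→ℚ 8 * K * I)
    regroup = solve-∀ ℚ-ring

lemma8p2 : (k m : ℕ) → 1 ℕ.≤ k → 1 ℕ.≤ m → (γ : ℚ) → 0ℚ < γ → γ < 1ℚ →
    dTV k m (Dpure k m γ) (Dmixed k m γ)
      ≤ ℕ→ℚ (m ℕ.* m) * γ * γ * inv (32 ℕ.* k)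
lemma8p2 (suc k′) m _ _ γ 0<γ γ<1 = begin
  dTV (suc k′) m (Dpure (suc k′) m γ) (Dmixed (suc k′) m γ)   ≡⟨⟩
  ½ * gap m                                                   ≤⟨ *-monoˡ-≤-0≤ (ℚ.nonNegative⁻¹ ½) (gap≤ m) ⟩
  ½ * (ℕ→ℚ (m ℕ.* m) * H)                                     ≡⟨ ½*m²*H≡ m ⟩
  ℕ→ℚ (m ℕ.* m) * γ * γ * inv (32 ℕ.* suc k′)                 ∎
  where
  open ℚ.≤-Reasoning
  open Construction k′ γ (ℚ.<⇒≤ 0<γ) (ℚ.<⇒≤ γ<1)
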